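{- Suppose that the edges of $K_n$ are coloured with the $3$ colours red, blue, green. Then there is a set $S\subseteq V(K_n)$ with $|S|<41002$ such that $K_n\setminus S$ satisfies one of the following. (i) $K_n\setminus S$ is either empty or $4$-connected in some colour. (ii) The colouring of $K_n\setminus S$ is 4-partite, with every class of the 4-partition having at least $3$ vertices. (iii) $V(K_n)\setminus S$ can be partitioned into four sets $A_{r,b}, A_{b,g}, A_{r,g}, W$ such that: all edges between $A_{r,g}$ and $A_{b,g}$ are green, all edges between $A_{r,b}$ and $A_{b,g}$ are blue, and all edges between $A_{r,b}$ and $A_{r,g}$ are red; all edges between $A_{r,b}$ and $W$ are red or blue, all edges between $A_{r,g}$ and $W$ are red or green, and all edges between $A_{b,g}$ and $W$ are blue or green; and $|A_{r,b}|, |A_{b,g}|, |A_{r,g}| \geq 400$.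
   Context: $K_n\setminus S$ is the complete graph on $V(K_n)\setminus S$ with the inherited colouring. A coloured graph is $k$-connected in a colour if the spanning subgraph formed by the edges of that colour is $k$-vertex-connected. A 3-edge-colouring of a complete graph is 4-partite if its vertex set can be partitioned into four nonempty sets (classes) $A_1,A_2,A_3,A_4$ such that all edges between $A_1$ and $A_4$ and between $A_2$ and $A_3$ are red, all edges between $A_2$ and $A_4$ and between $A_1$ and $A_3$ are blue, and all edges between $A_3$ and $A_4$ and between $A_1$ and $A_2$ are green (edges inside the classes are arbitrary). -}

module Defs where

open import Data.Nat using (ℕ; _<_; _≤_)
open import Data.Fin using (Fin; zero; suc; _≟_)
open import Data.Fin.Subset using (Subset; _∈_; _∉_; _⊆_; _∩_; _─_; ∣_∣)
open import Data.Vec using (tabulate)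
open import Data.Product using (_×_; Σ)
open import Data.Sum using (_⊎_)
open import Relation.Nullary using (¬_)
open import Relation.Nullary.Decidable using (⌊_⌋)
open import Relation.Binary.PropositionalEquality using (_≡_; _≢_)

data Colour : Set where
  red blue green : Colour

-- A 3-edge-colouring of K_n on vertex set Fin n: a symmetric colour
-- function; the values on the diagonal (loops) are irrelevant.
record Colouring (n : ℕ) : Set where
  field
    col : Fin n → Fin n → Colour
    col-sym : ∀ u v → col u v ≡ col v u
open Colouring public

data Path {n : ℕ} (χ : Colouring n) (c : Colour) (V : Subset n) :
          Fin n → Fin n → Set where
  here : ∀ {u} → u ∈ V → Path χ c V u u
  step : ∀ {u v w} → u ∈ V → u ≢ v → col χ u v ≡ c →
         Path χ c V v w → Path χ c V u w

Connected : {n : ℕ} → Colouring n → Colour → Subset n → Set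
Connected χ c V = ∀ u v → u ∈ V → v ∈ V → Path χ c V u v

KConnectedIn : {n : ℕ} → ℕ → Colouring n → Colour → Subset n → Set
KConnectedIn {n} k χ c V =
  (k < ∣ V ∣) × (∀ (T : Subset n) → T ⊆ V → ∣ T ∣ < k → Connected χ c (V ─ T))

EmptySet : {n : ℕ} → Subset n → Set
EmptySet {n} V = ∀ (v : Fin n) → v ∉ V

cls : {n : ℕ} → Subset n → (Fin n → Fin 4) → Fin 4 → Subset n
cls V p i = V ∩ tabulate (λ v → ⌊ p v ≟ i ⌋)

c₁ c₂ c₃ c₄ : Fin 4
c₁ = zero
c₂ = suc zero
c₃ = suc (suc zero)
c₄ = suc (suc (suc zero))

Between : {n : ℕ} → Colouring n → Subset n → (Fin n → Fin 4) →
          Fin 4 → Fin 4 → (Colour → Set) → Set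
Between χ V p i j P =
  ∀ u v → u ∈ V → v ∈ V → p u ≡ i → p v ≡ j → P (col χ u v)

-- Condition (ii): the colouring on V is 4-partite with classes
-- A₁ = class c₁, …, A₄ = class c₄ (the partition of V given by p),
-- each class having at least m vertices (m ≥ 1 gives nonemptiness).
FourPartite : {n : ℕ} → ℕ → Colouring n → Subset n → Set
FourPartite {n} m χ V = Σ (Fin n → Fin 4) λ p →
  (∀ i → m ≤ ∣ cls V p i ∣) ×
  Between χ V p c₁ c₄ (_≡ red) × Between χ V p c₂ c₃ (_≡ red) ×
  Between χ V p c₂ c₄ (_≡ blue) × Between χ V p c₁ c₃ (_≡ blue) ×
  Between χ V p c₃ c₄ (_≡ green) × Between χ V p c₁ c₂ (_≡ green)

-- Condition (iii): V is partitioned (via p) into A_rb = class c₁,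
-- A_bg = class c₂, A_rg = class c₃, W = class c₄.
ThreeAndW : {n : ℕ} → ℕ → Colouring n → Subset n → Set
ThreeAndW {n} m χ V = Σ (Fin n → Fin 4) λ p →
  m ≤ ∣ cls V p c₁ ∣ × m ≤ ∣ cls V p c₂ ∣ × m ≤ ∣ cls V p c₃ ∣ ×
  Between χ V p c₃ c₂ (_≡ green) ×
  Between χ V p c₁ c₂ (_≡ blue) ×
  Between χ V p c₁ c₃ (_≡ red) ×
  Between χ V p c₁ c₄ (λ x → x ≡ red ⊎ x ≡ blue) ×
  Between χ V p c₃ c₄ (λ x → x ≡ red ⊎ x ≡ green) ×
  Between χ V p c₂ c₄ (λ x → x ≡ blue ⊎ x ≡ green)

-- One colour c at a time: on a vertex set V with |V| ≥ 6M, keep deleted vertices T and peeled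
-- vertices P, with no c-edge from P to the rest R = V ─ T ─ P, and |T| ≤ 3|P| < 3M.  If R is
-- 4-connected in c, delete T ∪ P (at most 4M vertices).  Otherwise a cut of at most 3 vertices
-- splits R into two parts with no c-edge between them: if both have M vertices they give a
-- c-separation, and otherwise the small part is peeled and the cut deleted, which keeps
-- |T| ≤ 3|P| because P grew.  Once |P| ≥ M, P and R form a c-separation.
--
-- Running this for red, blue and green with M = 6432, 1608, 402 (so that 6432 = 1608 + 3·1608 and
-- 1608 = 402 + 3·402: later deletions leave every earlier separation with sides of 402 vertices)
-- either makes some colour 4-connected or gives three separations.  The red and blue ones cut the
-- vertices into four corners, and every edge between two opposite corners is green.  If all
-- corners are nonempty, the green separation therefore has one pair of opposite corners on each
-- side, which forces the colour between any two corners: the colouring is 4-partite.  Otherwise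
-- delete a corner of at most 2 vertices, leaving an empty corner, say X ∩ Q for red sides X | Y and
-- blue sides P | Q.  All X–Q edges are then green, so X ∪ Q lies on one green side; the other green
-- side H, X, Q and the remaining vertices are the classes of alternative (iii).

{-# OPTIONS --safe #-}
module Submission where

open import Defs
open import Data.Empty using (⊥-elim)
open import Data.Fin.Base using (Fin; zero; suc)
open import Data.Fin.Properties using (any?) renaming (_≟_ to _≟ᶠ_)
open import Data.Fin.Subset
open import Data.Fin.Subset.Properties
open import Data.Nat.Base using (ℕ; zero; suc; _+_; _*_; _∸_; _≤_; _<_; _≤ᵇ_; z≤n; s≤s)
open import Data.Nat.Properties
  using (_<?_; _≤?_; ≤ᵇ⇒≤; ≤-trans; ≤-reflexive; <-≤-trans; ≤-<-trans; <⇒≤; <⇒≱; ≮⇒≥; ≰⇒>; ≤-pred; <-irrefl;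
         n∸n≡0; +-suc; +-comm; +-identityʳ; *-suc; m<m+n; m≤m+n; m≤n+m; +-mono-≤; +-monoˡ-≤; +-monoʳ-≤;
         +-cancelˡ-≤; +-cancelʳ-≤; *-monoʳ-≤; module ≤-Reasoning)
open import Data.Nat.Tactic.RingSolver using (solve-∀)
open import Data.Bool.Base using (T)
import Algebra.Lattice.Properties.BooleanAlgebra as BooleanAlgebraProperties
open import Data.Vec.Base using ([]; _∷_; here; there; lookup; tabulate)
open import Data.Vec.Properties using (lookup∘tabulate; lookup⇒[]=)
open import Data.Product using (Σ; ∃; ∃₂; _×_; _,_; proj₁; proj₂)
open import Data.Sum using (_⊎_; inj₁; inj₂; [_,_]′)
open import Relation.Binary.Definitions using (DecidableEquality)
open import Function.Base using (_∘_)
open import Relation.Binary.PropositionalEquality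
  using (_≡_; _≢_; refl; sym; trans; cong; subst; module ≡-Reasoning)
open import Relation.Nullary using (¬_; Dec; yes; no; contradiction)
open import Relation.Nullary.Decidable using (⌊_⌋; does; _×-dec_; ¬?; isYes≗does; dec-true; decidable-stable)

x∈p─q⇒x∉q : ∀ {n} (p q : Subset n) {x} → x ∈ p ─ q → x ∉ q
x∈p─q⇒x∉q (_ ∷ p) (_ ∷ q) (there x∈p─q) (there x∈q) = x∈p─q⇒x∉q p q x∈p─q x∈q

x∈p─q⁻ : ∀ {n} (p q : Subset n) {x} → x ∈ p ─ q → x ∈ p × x ∉ q
x∈p─q⁻ p q x∈ = p─q⊆p p q x∈ , x∈p─q⇒x∉q p q x∈

∣p∪q∣≤∣p∣+∣q∣ : ∀ {n} (p q : Subset n) → ∣ p ∪ q ∣ ≤ ∣ p ∣ + ∣ q ∣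
∣p∪q∣≤∣p∣+∣q∣ [] [] = z≤n
∣p∪q∣≤∣p∣+∣q∣ (inside ∷ p) (s ∷ q) =
  s≤s (≤-trans (∣p∪q∣≤∣p∣+∣q∣ p q) (+-monoʳ-≤ ∣ p ∣ (∣p∣≤∣x∷p∣ s q)))
∣p∪q∣≤∣p∣+∣q∣ (outside ∷ p) (inside ∷ q) =
  ≤-trans (s≤s (∣p∪q∣≤∣p∣+∣q∣ p q)) (≤-reflexive (sym (+-suc ∣ p ∣ ∣ q ∣)))
∣p∪q∣≤∣p∣+∣q∣ (outside ∷ p) (outside ∷ q) = ∣p∪q∣≤∣p∣+∣q∣ p q

p⊆q∪r⇒∣p∣≤∣q∣+∣r∣ : ∀ {n} {p : Subset n} (q r : Subset n) → p ⊆ q ∪ r → ∣ p ∣ ≤ ∣ q ∣ + ∣ r ∣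
p⊆q∪r⇒∣p∣≤∣q∣+∣r∣ q r p⊆q∪r = ≤-trans (p⊆q⇒∣p∣≤∣q∣ p⊆q∪r) (∣p∪q∣≤∣p∣+∣q∣ q r)

∣p∣≤∣q∣+∣p─q∣ : ∀ {n} (p q : Subset n) → ∣ p ∣ ≤ ∣ q ∣ + ∣ p ─ q ∣
∣p∣≤∣q∣+∣p─q∣ p q = p⊆q∪r⇒∣p∣≤∣q∣+∣r∣ q (p ─ q) split
  where
  split : p ⊆ q ∪ (p ─ q)
  split {x} x∈p with x ∈? q
  ... | yes x∈q = x∈p∪q⁺ (inj₁ x∈q)
  ... | no x∉q = x∈p∪q⁺ (inj₂ (x∈p∧x∉q⇒x∈p─q x∈p x∉q))

n≤∣p∣+∣∁p∣ : ∀ {n} (p : Subset n) → n ≤ ∣ p ∣ + ∣ ∁ p ∣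
n≤∣p∣+∣∁p∣ {n} p = subst (_≤ ∣ p ∣ + ∣ ∁ p ∣) (∣⊤∣≡n n)
  (p⊆q∪r⇒∣p∣≤∣q∣+∣r∣ p (∁ p) (⊆-reflexive (sym (p∪∁p≡⊤ p))))

∣∁[p─q]∣≤a+k : ∀ {n} (p q : Subset n) {a k} → ∣ ∁ p ∣ ≤ a → ∣ q ∣ ≤ k → ∣ ∁ (p ─ q) ∣ ≤ a + k
∣∁[p─q]∣≤a+k p q ∣∁p∣≤a ∣q∣≤k = ≤-trans (p⊆q∪r⇒∣p∣≤∣q∣+∣r∣ (∁ p) q split) (+-mono-≤ ∣∁p∣≤a ∣q∣≤k)
  where
  split : ∁ (p ─ q) ⊆ ∁ p ∪ q
  split {x} x∈ with x ∈? q | x ∈? p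
  ... | yes x∈q | _ = x∈p∪q⁺ (inj₂ x∈q)
  ... | no x∉q | yes x∈p = contradiction (x∈p∧x∉q⇒x∈p─q x∈p x∉q) (x∈∁p⇒x∉p x∈)
  ... | no _ | no x∉p = x∈p∪q⁺ (inj₁ (x∉p⇒x∈∁p x∉p))

∁-involutive : ∀ {n} (p : Subset n) → ∁ (∁ p) ≡ p
∁-involutive {n} = BooleanAlgebraProperties.¬-involutive (∪-∩-booleanAlgebra n)

x∉p∪q⁺ : ∀ {n} {p q : Subset n} {x} → x ∉ p → x ∉ q → x ∉ p ∪ q
x∉p∪q⁺ {p = p} {q} x∉p x∉q x∈p∪q = [ x∉p , x∉q ]′ (x∈p∪q⁻ p q x∈p∪q)

x∉p∪q⁻ : ∀ {n} {p q : Subset n} {x} → x ∉ p ∪ q → x ∉ p × x ∉ q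
x∉p∪q⁻ x∉p∪q = (λ x∈p → x∉p∪q (x∈p∪q⁺ (inj₁ x∈p))) , (λ x∈q → x∉p∪q (x∈p∪q⁺ (inj₂ x∈q)))

x∈p─[q∪r]⁻ : ∀ {n} (p q r : Subset n) {x} → x ∈ p ─ (q ∪ r) → x ∈ p × x ∉ q × x ∉ r
x∈p─[q∪r]⁻ p q r x∈ = let (x∈p , x∉q∪r) = x∈p─q⁻ p (q ∪ r) x∈ in x∈p , x∉p∪q⁻ x∉q∪r

∣p∣≤∣q∣+[∣r∣+∣p─q─r∣] : ∀ {n} (p q r : Subset n) → ∣ p ∣ ≤ ∣ q ∣ + (∣ r ∣ + ∣ p ─ q ─ r ∣)
∣p∣≤∣q∣+[∣r∣+∣p─q─r∣] p q r = ≤-trans (∣p∣≤∣q∣+∣p─q∣ p q) (+-monoʳ-≤ ∣ q ∣ (∣p∣≤∣q∣+∣p─q∣ (p ─ q) r))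

∣p∣<∣p∪q∣ : ∀ {n} (p q : Subset n) {x} → x ∈ q → x ∉ p → ∣ p ∣ < ∣ p ∪ q ∣
∣p∣<∣p∪q∣ p q x∈q x∉p = p⊂q⇒∣p∣<∣q∣ (p⊆p∪q q , _ , x∈p∪q⁺ (inj₂ x∈q) , x∉p)

0<∣p∣⇒Nonempty : ∀ {n} (p : Subset n) → 0 < ∣ p ∣ → Nonempty p
0<∣p∣⇒Nonempty (inside ∷ p) _ = zero , here
0<∣p∣⇒Nonempty (outside ∷ p) 0<∣p∣ with 0<∣p∣⇒Nonempty p 0<∣p∣
... | x , x∈p = suc x , there x∈p

_≟ᶜ_ : DecidableEquality Colour
red ≟ᶜ red = yes refl
red ≟ᶜ blue = no λ ()
red ≟ᶜ green = no λ ()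
blue ≟ᶜ red = no λ ()
blue ≟ᶜ blue = yes refl
blue ≟ᶜ green = no λ ()
green ≟ᶜ red = no λ ()
green ≟ᶜ blue = no λ ()
green ≟ᶜ green = yes refl

≢red⇒blue⊎green : ∀ {x} → x ≢ red → x ≡ blue ⊎ x ≡ green
≢red⇒blue⊎green {red} x≢red = contradiction refl x≢red
≢red⇒blue⊎green {blue} _ = inj₁ refl
≢red⇒blue⊎green {green} _ = inj₂ refl

≢blue⇒red⊎green : ∀ {x} → x ≢ blue → x ≡ red ⊎ x ≡ green
≢blue⇒red⊎green {red} _ = inj₁ refl
≢blue⇒red⊎green {blue} x≢blue = contradiction refl x≢blue
≢blue⇒red⊎green {green} _ = inj₂ refl

≢green⇒red⊎blue : ∀ {x} → x ≢ green → x ≡ red ⊎ x ≡ blue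
≢green⇒red⊎blue {red} _ = inj₁ refl
≢green⇒red⊎blue {blue} _ = inj₂ refl
≢green⇒red⊎blue {green} x≢green = contradiction refl x≢green

≢blue⇒≢green⇒red : ∀ {x} → x ≢ blue → x ≢ green → x ≡ red
≢blue⇒≢green⇒red {red} _ _ = refl
≢blue⇒≢green⇒red {blue} x≢blue _ = contradiction refl x≢blue
≢blue⇒≢green⇒red {green} _ x≢green = contradiction refl x≢green

≢red⇒≢green⇒blue : ∀ {x} → x ≢ red → x ≢ green → x ≡ blue
≢red⇒≢green⇒blue {red} x≢red _ = contradiction refl x≢red
≢red⇒≢green⇒blue {blue} _ _ = refl
≢red⇒≢green⇒blue {green} _ x≢green = contradiction refl x≢green

≢red⇒≢blue⇒green : ∀ {x} → x ≢ red → x ≢ blue → x ≡ green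
≢red⇒≢blue⇒green {red} x≢red _ = contradiction refl x≢red
≢red⇒≢blue⇒green {blue} _ x≢blue = contradiction refl x≢blue
≢red⇒≢blue⇒green {green} _ _ = refl

deleted-bound : ∀ {t t′ p q} → t ≤ 3 * p → t′ ≤ 3 → p < q → t + t′ ≤ 3 * q
deleted-bound {t} {t′} {p} {q} t≤3p t′≤3 p<q = begin
  t + t′     ≤⟨ +-mono-≤ t≤3p t′≤3 ⟩
  3 * p + 3  ≡⟨ +-comm (3 * p) 3 ⟩
  3 + 3 * p  ≡⟨ *-suc 3 p ⟨
  3 * suc p  ≤⟨ *-monoʳ-≤ 3 p<q ⟩
  3 * q      ∎
  where open ≤-Reasoning

removed-bound : ∀ {t p M} → t ≤ 3 * p → p < M → t + p ≤ 4 * M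
removed-bound {t} {p} {M} t≤3p p<M = begin
  t + p      ≤⟨ +-monoˡ-≤ p t≤3p ⟩
  3 * p + p  ≡⟨ +-comm (3 * p) p ⟩
  4 * p      ≤⟨ *-monoʳ-≤ 4 (<⇒≤ p<M) ⟩
  4 * M      ∎
  where open ≤-Reasoning

rest-not-tiny : ∀ {t p r v M} → t ≤ 3 * p → p < M → 1 ≤ M → 6 * M ≤ v → v ≤ t + (p + r) → ¬ r ≤ 4
rest-not-tiny {t} {p} {r} {v} {M} t≤3p p<M 1≤M 6M≤v v≤ r≤4 = <-irrefl refl (begin-strict
  6 * M            ≤⟨ 6M≤v ⟩
  v                ≤⟨ v≤ ⟩
  t + (p + r)      ≤⟨ +-mono-≤ t≤3p (+-monoʳ-≤ p r≤4) ⟩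
  3 * p + (p + 4)  ≡⟨ 3p+[p+4]≡4[1+p] p ⟩
  4 * suc p        ≤⟨ *-monoʳ-≤ 4 p<M ⟩
  4 * M            <⟨ m<m+n (4 * M) (≤-trans 1≤M (m≤m+n M _)) ⟩
  4 * M + 2 * M    ≡⟨ 4M+2M≡6M M ⟩
  6 * M            ∎)
  where
  open ≤-Reasoning
  3p+[p+4]≡4[1+p] : ∀ p → 3 * p + (p + 4) ≡ 4 * suc p
  3p+[p+4]≡4[1+p] = solve-∀
  4M+2M≡6M : ∀ M → 4 * M + 2 * M ≡ 6 * M
  4M+2M≡6M = solve-∀

rest-large : ∀ {t q r v M} → 6 * M ≤ v → v ≤ t + (q + r) → t ≤ 3 * M → q ≤ M + M → M ≤ r
rest-large {t} {q} {r} {v} {M} 6M≤v v≤ t≤3M q≤M+M = +-cancelˡ-≤ (5 * M) M r (begin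
  5 * M + M          ≡⟨ 5M+M≡6M M ⟩
  6 * M              ≤⟨ 6M≤v ⟩
  v                  ≤⟨ v≤ ⟩
  t + (q + r)        ≤⟨ +-mono-≤ t≤3M (+-monoˡ-≤ r q≤M+M) ⟩
  3 * M + ((M + M) + r) ≡⟨ 3M+[2M+r]≡5M+r M r ⟩
  5 * M + r          ∎)
  where
  open ≤-Reasoning
  5M+M≡6M : ∀ M → 5 * M + M ≡ 6 * M
  5M+M≡6M = solve-∀
  3M+[2M+r]≡5M+r : ∀ M r → 3 * M + ((M + M) + r) ≡ 5 * M + r
  3M+[2M+r]≡5M+r = solve-∀

module _ {n : ℕ} (χ : Colouring n) (c : Colour) where

  NoEdges : Subset n → Subset n → Set
  NoEdges A B = ∀ {x y} → x ∈ A → y ∈ B → col χ x y ≢ c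

  NoEdges-sym : ∀ {A B} → NoEdges A B → NoEdges B A
  NoEdges-sym none y∈B x∈A c≡ = none x∈A y∈B (trans (col-sym χ _ _) c≡)

  NoEdges-complement : ∀ {U X} → NoEdges X (U ─ X) → NoEdges (U ─ X) (U ─ (U ─ X))
  NoEdges-complement {U} {X} none y∈U─X z∈ with x∈p─q⁻ U (U ─ X) z∈
  ... | z∈U , z∉U─X with _ ∈? X
  ...   | yes z∈X = NoEdges-sym none y∈U─X z∈X
  ...   | no z∉X = contradiction (x∈p∧x∉q⇒x∈p─q z∈U z∉X) z∉U─X

  path-start : ∀ {U u v} → Path χ c U u v → u ∈ U
  path-start (here u∈U) = u∈U
  path-start (step u∈U _ _ _) = u∈U

  path-snoc : ∀ {U u x y} → Path χ c U u x → x ≢ y → col χ x y ≡ c → y ∈ U → Path χ c U u y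
  path-snoc (here x∈U) x≢y xy≡c y∈U = step x∈U x≢y xy≡c (here y∈U)
  path-snoc (step u∈U u≢v uv≡c p) x≢y xy≡c y∈U = step u∈U u≢v uv≡c (path-snoc p x≢y xy≡c y∈U)

  path-confined : ∀ {U X u w} → NoEdges X (U ─ X) → u ∈ X → Path χ c U u w → w ∈ X
  path-confined none u∈X (here _) = u∈X
  path-confined {X = X} none u∈X (step {v = v} _ _ uv≡c p) with v ∈? X
  ... | yes v∈X = path-confined none v∈X p
  ... | no v∉X = contradiction uv≡c (none u∈X (x∈p∧x∉q⇒x∈p─q (path-start p) v∉X))

  record Reached (U : Subset n) (u : Fin n) (X : Subset n) : Set where
    field
      reached⊆ : X ⊆ U
      root : u ∈ X
      reachable : ∀ {y} → y ∈ X → Path χ c U u y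

  isolated-or-extend : ∀ {U u X} → Reached U u X →
    NoEdges X (U ─ X) ⊎ ∃ λ y → y ∉ X × Reached U u (X ∪ ⁅ y ⁆)
  isolated-or-extend {U} {u} {X} r
    with any? (λ x → any? (λ y → (x ∈? X) ×-dec (y ∈? U ─ X) ×-dec (col χ x y ≟ᶜ c)))
  ... | no ∄edge = inj₁ λ x∈X y∈U─X xy≡c → ∄edge (_ , _ , x∈X , y∈U─X , xy≡c)
  ... | yes (x , y , x∈X , y∈U─X , xy≡c) = inj₂ (y , y∉X , record
        { reached⊆ = λ z∈ → [ reached⊆ , (λ z∈⁅y⁆ → subst (_∈ U) (sym (x∈⁅y⁆⇒x≡y y z∈⁅y⁆)) y∈U) ]′
                              (x∈p∪q⁻ X ⁅ y ⁆ z∈)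
        ; root = x∈p∪q⁺ (inj₁ root)
        ; reachable = λ z∈ → [ reachable , (λ z∈⁅y⁆ → subst (Path χ c U u) (sym (x∈⁅y⁆⇒x≡y y z∈⁅y⁆)) path-to-y) ]′
                              (x∈p∪q⁻ X ⁅ y ⁆ z∈) })
    where
    open Reached r
    y∈U : y ∈ U
    y∈U = proj₁ (x∈p─q⁻ U X y∈U─X)
    y∉X : y ∉ X
    y∉X = proj₂ (x∈p─q⁻ U X y∈U─X)
    path-to-y : Path χ c U u y
    path-to-y = path-snoc (reachable x∈X) (λ x≡y → y∉X (subst (_∈ X) x≡y x∈X)) xy≡c y∈U

  component : ∀ {U u} → u ∈ U → ∃ λ X → Reached U u X × NoEdges X (U ─ X)
  component {U} {u} u∈U = grow n (m≤n+m n ∣ ⁅ u ⁆ ∣) (record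
    { reached⊆ = λ z∈ → subst (_∈ U) (sym (x∈⁅y⁆⇒x≡y u z∈)) u∈U
    ; root = x∈⁅x⁆ u
    ; reachable = λ z∈ → subst (Path χ c U u) (sym (x∈⁅y⁆⇒x≡y u z∈)) (here u∈U) })
    where
    grow : ∀ {X} fuel → n ≤ ∣ X ∣ + fuel → Reached U u X → ∃ λ X → Reached U u X × NoEdges X (U ─ X)
    grow {X} fuel n≤ r with isolated-or-extend r
    ... | inj₁ none = X , r , none
    ... | inj₂ (y , y∉X , r′) with ∣p∣<∣p∪q∣ X ⁅ y ⁆ (x∈⁅x⁆ y) y∉X | fuel
    ...   | grows | zero =
              contradiction (subst (n ≤_) (+-identityʳ _) n≤) (<⇒≱ (<-≤-trans grows (∣p∣≤n (X ∪ ⁅ y ⁆))))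
    ...   | grows | suc fuel′ =
              grow fuel′ (≤-trans n≤ (≤-trans (≤-reflexive (+-suc _ fuel′)) (+-monoˡ-≤ fuel′ grows))) r′

  path? : ∀ U u v → Dec (Path χ c U u v)
  path? U u v with u ∈? U
  ... | no u∉U = no λ p → u∉U (path-start p)
  ... | yes u∈U with component u∈U
  ...   | X , r , none with v ∈? X
  ...     | yes v∈X = yes (Reached.reachable r v∈X)
  ...     | no v∉X = no λ p → v∉X (path-confined none (Reached.root r) p)

  Cut : ℕ → Subset n → Set
  Cut k V = ∃ λ T → T ⊆ V × ∣ T ∣ < k ×
    ∃₂ λ u v → u ∈ V ─ T × v ∈ V ─ T × ¬ Path χ c (V ─ T) u v

  connected-or-cut : ∀ k V → KConnectedIn k χ c V ⊎ ∣ V ∣ ≤ k ⊎ Cut k V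
  connected-or-cut k V
    with anySubset? (λ T → (T ⊆? V) ×-dec (∣ T ∣ <? k) ×-dec
           any? (λ u → any? (λ v → (u ∈? V ─ T) ×-dec (v ∈? V ─ T) ×-dec ¬? (path? (V ─ T) u v))))
  ... | yes cut = inj₂ (inj₂ cut)
  ... | no ∄cut with k <? ∣ V ∣
  ...   | no k≮∣V∣ = inj₂ (inj₁ (≮⇒≥ k≮∣V∣))
  ...   | yes k<∣V∣ = inj₁ (k<∣V∣ , connected)
    where
    connected : ∀ T → T ⊆ V → ∣ T ∣ < k → Connected χ c (V ─ T)
    connected T T⊆V ∣T∣<k u v u∈ v∈ with path? (V ─ T) u v
    ... | yes p = p
    ... | no ¬p = ⊥-elim (∄cut (T , T⊆V , ∣T∣<k , u , v , u∈ , v∈ , ¬p))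

  record Separation (V : Subset n) (m : ℕ) : Set where
    field
      left right : Subset n
      left⊆ : left ⊆ V
      right⊆ : right ⊆ V
      covers : ∀ {v} → v ∈ V → v ∈ left ⊎ v ∈ right
      disjoint : ∀ {v} → v ∈ left → v ∉ right
      no-c-edges : NoEdges left right
      left-size : m ≤ ∣ left ∣
      right-size : m ≤ ∣ right ∣

    ∉right⇒left : ∀ {v} → v ∈ V → v ∉ right → v ∈ left
    ∉right⇒left v∈V v∉right = [ (λ v∈left → v∈left) , (λ v∈right → contradiction v∈right v∉right) ]′ (covers v∈V)

    ∉left⇒right : ∀ {v} → v ∈ V → v ∉ left → v ∈ right
    ∉left⇒right v∈V v∉left = [ (λ v∈left → contradiction v∈left v∉left) , (λ v∈right → v∈right) ]′ (covers v∈V)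

    no-c-edges-sym : NoEdges right left
    no-c-edges-sym = NoEdges-sym no-c-edges

    left-closed : ∀ {x y} → x ∈ left → y ∈ V → col χ x y ≡ c → y ∈ left
    left-closed x∈left y∈V xy≡c = ∉right⇒left y∈V λ y∈right → no-c-edges x∈left y∈right xy≡c


  open Separation

  swap : ∀ {V m} → Separation V m → Separation V m
  swap s = record
    { left = right s ; right = left s ; left⊆ = right⊆ s ; right⊆ = left⊆ s
    ; covers = λ v∈V → Data.Sum.swap (covers s v∈V)
    ; disjoint = λ v∈right v∈left → disjoint s v∈left v∈right
    ; no-c-edges = NoEdges-sym (no-c-edges s)
    ; left-size = right-size s ; right-size = left-size s }

  orient : ∀ {V m v} → Separation V m → v ∈ V → Σ (Separation V m) λ s → v ∈ left s
  orient s v∈V = [ (λ v∈left → s , v∈left) , (λ v∈right → swap s , v∈right) ]′ (covers s v∈V)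

  restrict : ∀ {V m k} T → ∣ T ∣ ≤ k → Separation V (m + k) → Separation (V ─ T) m
  restrict {V} {m} {k} T ∣T∣≤k s = record
    { left = left s ─ T ; right = right s ─ T
    ; left⊆ = without-T (left⊆ s) ; right⊆ = without-T (right⊆ s)
    ; covers = λ v∈ → let (v∈V , v∉T) = x∈p─q⁻ V T v∈ in
        Data.Sum.map (λ v∈left → x∈p∧x∉q⇒x∈p─q v∈left v∉T) (λ v∈right → x∈p∧x∉q⇒x∈p─q v∈right v∉T)
                     (covers s v∈V)
    ; disjoint = λ v∈left v∈right → disjoint s (p─q⊆p (left s) T v∈left) (p─q⊆p (right s) T v∈right)
    ; no-c-edges = λ x∈ y∈ → no-c-edges s (p─q⊆p (left s) T x∈) (p─q⊆p (right s) T y∈)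
    ; left-size = shrink (left s) (left-size s) ; right-size = shrink (right s) (right-size s) }
    where
    without-T : ∀ {A} → A ⊆ V → A ─ T ⊆ V ─ T
    without-T {A} A⊆V v∈ = let (v∈A , v∉T) = x∈p─q⁻ A T v∈ in x∈p∧x∉q⇒x∈p─q (A⊆V v∈A) v∉T
    shrink : ∀ A → m + k ≤ ∣ A ∣ → m ≤ ∣ A ─ T ∣
    shrink A m+k≤ = +-cancelˡ-≤ k m ∣ A ─ T ∣ (begin
      k + m            ≡⟨ +-comm k m ⟩
      m + k            ≤⟨ m+k≤ ⟩
      ∣ A ∣            ≤⟨ ∣p∣≤∣q∣+∣p─q∣ A T ⟩
      ∣ T ∣ + ∣ A ─ T ∣ ≤⟨ +-monoˡ-≤ ∣ A ─ T ∣ ∣T∣≤k ⟩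
      k + ∣ A ─ T ∣    ∎)
      where open ≤-Reasoning

  isolated⇒Separation : ∀ {W A m} → A ⊆ W → NoEdges A (W ─ A) →
    m ≤ ∣ A ∣ → m ≤ ∣ W ─ A ∣ → Separation W m
  isolated⇒Separation {W} {A} A⊆W none m≤∣A∣ m≤∣W─A∣ = record
    { left = A ; right = W ─ A ; left⊆ = A⊆W ; right⊆ = p─q⊆p W A
    ; covers = covers′
    ; disjoint = λ v∈A v∈W─A → x∈p─q⇒x∉q W A v∈W─A v∈A
    ; no-c-edges = none ; left-size = m≤∣A∣ ; right-size = m≤∣W─A∣ }
    where
    covers′ : ∀ {v} → v ∈ W → v ∈ A ⊎ v ∈ W ─ A
    covers′ {v} v∈W with v ∈? A
    ... | yes v∈A = inj₁ v∈A
    ... | no v∉A = inj₂ (x∈p∧x∉q⇒x∈p─q v∈W v∉A)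

  complete-bipartite⊆left : ∀ {V m A B a b} (s : Separation V m) → A ⊆ V → B ⊆ V →
             (∀ {x y} → x ∈ A → y ∈ B → col χ x y ≡ c) → a ∈ A → b ∈ B → a ∈ left s →
             A ⊆ left s × B ⊆ left s
  complete-bipartite⊆left s A⊆V B⊆V edges a∈A b∈B a∈left = A⊆left , B⊆left
    where
    B⊆left : _ ⊆ left s
    B⊆left y∈B = left-closed s a∈left (B⊆V y∈B) (edges a∈A y∈B)
    A⊆left : _ ⊆ left s
    A⊆left x∈A = left-closed s (B⊆left b∈B) (A⊆V x∈A) (trans (col-sym χ _ _) (edges x∈A b∈B))

  Outcome : Subset n → ℕ → Set
  Outcome V M = (∃ λ D → ∣ D ∣ ≤ 4 * M × KConnectedIn 4 χ c (V ─ D))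
              ⊎ (∃ λ T → ∣ T ∣ ≤ 3 * M × Separation (V ─ T) M)

  module Peel {V : Subset n} {M : ℕ} (1≤M : 1 ≤ M) (6M≤∣V∣ : 6 * M ≤ ∣ V ∣) where

    record Peeling (T P : Subset n) : Set where
      field
        peeled⊆ : P ⊆ V ─ T
        few-deleted : ∣ T ∣ ≤ 3 * ∣ P ∣
        few-peeled : ∣ P ∣ < M
        peeled-isolated : NoEdges P (V ─ T ─ P)

    Step : Subset n → Subset n → Set
    Step T P = Outcome V M ⊎ ∃₂ λ T₂ P₂ → Peeling T₂ P₂ × ∣ P ∣ < ∣ P₂ ∣

    module At-cut {T P T′ : Subset n} (pl : Peeling T P) (T′⊆ : T′ ⊆ V ─ T ─ P) (∣T′∣≤3 : ∣ T′ ∣ ≤ 3) where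

      open Peeling pl

      outside-cut : ∀ {x} → x ∈ V ─ T ─ P ─ T′ → x ∈ V × x ∉ T × x ∉ P × x ∉ T′
      outside-cut x∈ =
        let (x∈V─T─P , x∉T′) = x∈p─q⁻ (V ─ T ─ P) T′ x∈
            (x∈V─T , x∉P) = x∈p─q⁻ (V ─ T) P x∈V─T─P
            (x∈V , x∉T) = x∈p─q⁻ V T x∈V─T
        in x∈V , x∉T , x∉P , x∉T′

      outside-cut⁺ : ∀ {x} → x ∈ V → x ∉ T → x ∉ P → x ∉ T′ → x ∈ V ─ T ─ P ─ T′
      outside-cut⁺ x∈V x∉T x∉P x∉T′ =
        x∈p∧x∉q⇒x∈p─q (x∈p∧x∉q⇒x∈p─q (x∈p∧x∉q⇒x∈p─q x∈V x∉T) x∉P) x∉T′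

      peeled-outside-cut : ∀ {x} → x ∈ P → x ∉ T′
      peeled-outside-cut x∈P x∈T′ = x∈p─q⇒x∉q (V ─ T) P (T′⊆ x∈T′) x∈P

      remaining : ∀ {x} → x ∈ V → x ∉ T → x ∉ T′ → x ∈ V ─ (T ∪ T′)
      remaining x∈V x∉T x∉T′ = x∈p∧x∉q⇒x∈p─q x∈V (x∉p∪q⁺ x∉T x∉T′)

      few-deleted′ : ∀ {q} → ∣ P ∣ < q → ∣ T ∪ T′ ∣ ≤ 3 * q
      few-deleted′ ∣P∣<q = ≤-trans (∣p∪q∣≤∣p∣+∣q∣ T T′) (deleted-bound few-deleted ∣T′∣≤3 ∣P∣<q)

      module _ {S : Subset n} (S⊆ : S ⊆ V ─ T ─ P ─ T′) where

        P∪S⊆ : P ∪ S ⊆ V ─ (T ∪ T′)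
        P∪S⊆ x∈ with x∈p∪q⁻ P S x∈
        ... | inj₁ x∈P = let (x∈V , x∉T) = x∈p─q⁻ V T (peeled⊆ x∈P) in
                          remaining x∈V x∉T (peeled-outside-cut x∈P)
        ... | inj₂ x∈S = let (x∈V , x∉T , _ , x∉T′) = outside-cut (S⊆ x∈S) in remaining x∈V x∉T x∉T′

        P∪S-isolated : NoEdges S (V ─ T ─ P ─ T′ ─ S) → NoEdges (P ∪ S) (V ─ (T ∪ T′) ─ (P ∪ S))
        P∪S-isolated S-isolated x∈ y∈ with x∈p─q⁻ (V ─ (T ∪ T′)) (P ∪ S) y∈
        ... | y∈V─T₂ , y∉P₂ with x∈p─[q∪r]⁻ V T T′ y∈V─T₂ | x∉p∪q⁻ y∉P₂ | x∈p∪q⁻ P S x∈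
        ...   | y∈V , y∉T , _ | y∉P , _ | inj₁ x∈P =
                  peeled-isolated x∈P (x∈p∧x∉q⇒x∈p─q (x∈p∧x∉q⇒x∈p─q y∈V y∉T) y∉P)
        ...   | y∈V , y∉T , y∉T′ | y∉P , y∉S | inj₂ x∈S =
                  S-isolated x∈S (x∈p∧x∉q⇒x∈p─q (outside-cut⁺ y∈V y∉T y∉P y∉T′) y∉S)

      separate : ∀ {S} → S ⊆ V ─ T ─ P ─ T′ → NoEdges S (V ─ T ─ P ─ T′ ─ S) →
                 M ≤ ∣ P ∪ S ∣ → M ≤ ∣ V ─ (T ∪ T′) ─ (P ∪ S) ∣ → Step T P
      separate S⊆ S-isolated M≤∣P∪S∣ M≤∣rest∣ = inj₁ (inj₂ (T ∪ T′ , few-deleted′ few-peeled ,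
        isolated⇒Separation (P∪S⊆ S⊆) (P∪S-isolated S⊆ S-isolated) M≤∣P∪S∣ M≤∣rest∣))

      peel-more : ∀ {S} → S ⊆ V ─ T ─ P ─ T′ → Nonempty S → ∣ S ∣ < M →
                  NoEdges S (V ─ T ─ P ─ T′ ─ S) → Step T P
      peel-more {S} S⊆ (s , s∈S) ∣S∣<M S-isolated with M ≤? ∣ P ∪ S ∣
      ... | yes M≤∣P∪S∣ = separate S⊆ S-isolated M≤∣P∪S∣
            (rest-large 6M≤∣V∣ (∣p∣≤∣q∣+[∣r∣+∣p─q─r∣] V (T ∪ T′) (P ∪ S)) (few-deleted′ few-peeled)
              (≤-trans (∣p∪q∣≤∣p∣+∣q∣ P S) (+-mono-≤ (<⇒≤ few-peeled) (<⇒≤ ∣S∣<M))))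
      ... | no M≰∣P∪S∣ = inj₂ (T ∪ T′ , P ∪ S , record
            { peeled⊆ = P∪S⊆ S⊆ ; few-deleted = few-deleted′ grows
            ; few-peeled = ≰⇒> M≰∣P∪S∣ ; peeled-isolated = P∪S-isolated S⊆ S-isolated } , grows)
        where
        grows : ∣ P ∣ < ∣ P ∪ S ∣
        grows = ∣p∣<∣p∪q∣ P S s∈S (proj₁ (proj₂ (proj₂ (outside-cut (S⊆ s∈S)))))

      split-at-cut : ∀ {u v} → u ∈ V ─ T ─ P ─ T′ → v ∈ V ─ T ─ P ─ T′ →
                     ¬ Path χ c (V ─ T ─ P ─ T′) u v → Step T P
      split-at-cut {u} {v} u∈U v∈U ¬path with component u∈U
      ... | X , reached , X-isolated with M ≤? ∣ X ∣ | M ≤? ∣ V ─ T ─ P ─ T′ ─ X ∣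
      ...   | no M≰∣X∣ | _ =
                peel-more (Reached.reached⊆ reached) (u , Reached.root reached) (≰⇒> M≰∣X∣) X-isolated
      ...   | yes _ | no M≰∣Y∣ =
                peel-more (p─q⊆p _ X) (v , x∈p∧x∉q⇒x∈p─q v∈U (¬path ∘ Reached.reachable reached))
                  (≰⇒> M≰∣Y∣) (NoEdges-complement X-isolated)
      ...   | yes M≤∣X∣ | yes M≤∣Y∣ =
                separate (Reached.reached⊆ reached) X-isolated (≤-trans M≤∣X∣ (∣q∣≤∣p∪q∣ P X))
                  (≤-trans M≤∣Y∣ (p⊆q⇒∣p∣≤∣q∣ Y⊆rest))
        where
        Y⊆rest : V ─ T ─ P ─ T′ ─ X ⊆ V ─ (T ∪ T′) ─ (P ∪ X)
        Y⊆rest y∈ = let (y∈U , y∉X) = x∈p─q⁻ _ X y∈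
                        (y∈V , y∉T , y∉P , y∉T′) = outside-cut y∈U
                    in x∈p∧x∉q⇒x∈p─q (remaining y∈V y∉T y∉T′) (x∉p∪q⁺ y∉P y∉X)

    peel-step : ∀ {T P} → Peeling T P → Step T P
    peel-step {T} {P} pl with connected-or-cut 4 (V ─ T ─ P)
    ... | inj₁ connected = inj₁ (inj₁ (T ∪ P ,
          ≤-trans (∣p∪q∣≤∣p∣+∣q∣ T P) (removed-bound few-deleted few-peeled) ,
          subst (KConnectedIn 4 χ c) (p─q─r≡p─q∪r V T P) connected))
      where open Peeling pl
    ... | inj₂ (inj₁ tiny) = contradiction tiny
          (rest-not-tiny few-deleted few-peeled 1≤M 6M≤∣V∣ (∣p∣≤∣q∣+[∣r∣+∣p─q─r∣] V T P))
      where open Peeling pl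
    ... | inj₂ (inj₂ (T′ , T′⊆ , ∣T′∣<4 , _ , _ , u∈ , v∈ , ¬path)) =
          At-cut.split-at-cut pl T′⊆ (≤-pred ∣T′∣<4) u∈ v∈ ¬path

    peel : ∀ {T P} fuel → M ≤ ∣ P ∣ + fuel → Peeling T P → Outcome V M
    peel {P = P} zero M≤∣P∣+0 pl =
      contradiction (subst (M ≤_) (+-identityʳ ∣ P ∣) M≤∣P∣+0) (<⇒≱ (Peeling.few-peeled pl))
    peel {P = P} (suc fuel) M≤ pl with peel-step pl
    ... | inj₁ outcome = outcome
    ... | inj₂ (_ , P₂ , pl₂ , grows) =
          peel fuel (≤-trans M≤ (≤-trans (≤-reflexive (+-suc ∣ P ∣ fuel)) (+-monoˡ-≤ fuel grows))) pl₂

  connected-or-separated : ∀ V M → 1 ≤ M → 6 * M ≤ ∣ V ∣ → Outcome V M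
  connected-or-separated V M 1≤M 6M≤∣V∣ = peel {⊥} {⊥} M (m≤n+m M ∣ ⊥ {n} ∣) (record
    { peeled⊆ = ⊥⊆
    ; few-deleted = subst (λ k → k ≤ 3 * k) (sym (∣⊥∣≡0 n)) z≤n
    ; few-peeled = subst (_< M) (sym (∣⊥∣≡0 n)) 1≤M
    ; peeled-isolated = λ x∈⊥ → contradiction x∈⊥ ∉⊥ })
    where open Peel {V} 1≤M 6M≤∣V∣

∈cls : ∀ {n} {V : Subset n} {p : Fin n → Fin 4} {i v} → v ∈ V → p v ≡ i → v ∈ cls V p i
∈cls {p = p} {i} {v} v∈V pv≡i =
  x∈p∩q⁺ (v∈V , lookup⇒[]= v _ (begin
    lookup (tabulate λ w → ⌊ p w ≟ᶠ i ⌋) v  ≡⟨ lookup∘tabulate _ v ⟩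
    ⌊ p v ≟ᶠ i ⌋                            ≡⟨ isYes≗does (p v ≟ᶠ i) ⟩
    does (p v ≟ᶠ i)                         ≡⟨ dec-true (p v ≟ᶠ i) pv≡i ⟩
    inside                                  ∎))
  where open ≡-Reasoning

module Labelling {n : ℕ} (χ : Colouring n) {V : Subset n} (A : Fin 4 → Subset n)
  (covers : ∀ {v} → v ∈ V → ∃ λ i → v ∈ A i)
  (unique : ∀ {v} i j → v ∈ A i → v ∈ A j → i ≡ j) where

  label : Fin n → Fin 4
  label v with any? (λ i → v ∈? A i)
  ... | yes (i , _) = i
  ... | no _ = c₄  -- junk label: only vertices outside V lie in no class

  label-correct : ∀ {v i} → v ∈ A i → label v ≡ i
  label-correct {v} {i} v∈Aᵢ with any? (λ j → v ∈? A j)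
  ... | yes (j , v∈Aⱼ) = unique j i v∈Aⱼ v∈Aᵢ
  ... | no ∄j = contradiction (i , v∈Aᵢ) ∄j

  label-sound : ∀ {v i} → v ∈ V → label v ≡ i → v ∈ A i
  label-sound {v} v∈V label≡i with covers v∈V
  ... | j , v∈Aⱼ = subst (λ k → v ∈ A k) (trans (sym (label-correct v∈Aⱼ)) label≡i) v∈Aⱼ

  class-size : ∀ i → A i ⊆ V → ∣ A i ∣ ≤ ∣ cls V label i ∣
  class-size i A⊆V = p⊆q⇒∣p∣≤∣q∣ λ v∈Aᵢ → ∈cls {p = label} (A⊆V v∈Aᵢ) (label-correct v∈Aᵢ)

  between : ∀ {i j} (P : Colour → Set) → (∀ {u v} → u ∈ A i → v ∈ A j → P (col χ u v)) →
            Between χ V label i j P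
  between _ edges _ _ u∈V v∈V label≡i label≡j = edges (label-sound u∈V label≡i) (label-sound v∈V label≡j)

module _ {n : ℕ} {χ : Colouring n} where

  open Separation

  module EmptyCorner {V m₁ m₂} (r : Separation χ red V m₁) (b : Separation χ blue V m₂)
                     (corner-empty : ∀ {v} → v ∈ left r → v ∉ right b) where

    X Q : Subset n
    X = left r
    Q = right b

    X⊆P : X ⊆ left b
    X⊆P x∈X = ∉right⇒left b (left⊆ r x∈X) (corner-empty x∈X)
    Q⊆Y : Q ⊆ right r
    Q⊆Y q∈Q = ∉left⇒right r (right⊆ b q∈Q) λ q∈X → corner-empty q∈X q∈Q
    X-Q-green : ∀ {x q} → x ∈ X → q ∈ Q → col χ x q ≡ green
    X-Q-green x∈X q∈Q = ≢red⇒≢blue⇒green (no-c-edges r x∈X (Q⊆Y q∈Q)) (no-c-edges b (X⊆P x∈X) q∈Q)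

    green-side : ∀ {m₃} → Nonempty X → Nonempty Q → Separation χ green V m₃ →
                 Σ (Separation χ green V m₃) λ g → X ⊆ left g × Q ⊆ left g
    green-side (x , x∈X) (q , q∈Q) g₀ with orient χ green g₀ (left⊆ r x∈X)
    ... | g , x∈G = g , complete-bipartite⊆left χ green g (left⊆ r) (right⊆ b) X-Q-green x∈X q∈Q x∈G

    module Classes {m₃} (g : Separation χ green V m₃) (X⊆G : X ⊆ left g) (Q⊆G : Q ⊆ left g) where

      H W : Subset n
      H = right g
      W = V ─ H ─ X ─ Q

      H⊆Y : H ⊆ right r
      H⊆Y h∈H = ∉left⇒right r (right⊆ g h∈H) λ h∈X → disjoint g (X⊆G h∈X) h∈H
      H⊆P : H ⊆ left b
      H⊆P h∈H = ∉right⇒left b (right⊆ g h∈H) λ h∈Q → disjoint g (Q⊆G h∈Q) h∈H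
      W⊆V─H─X : W ⊆ V ─ H ─ X
      W⊆V─H─X = p─q⊆p (V ─ H ─ X) Q
      W⊆V─H : W ⊆ V ─ H
      W⊆V─H = p─q⊆p (V ─ H) X ∘ W⊆V─H─X
      W∌H : ∀ {w} → w ∈ W → w ∉ H
      W∌H = x∈p─q⇒x∉q V H ∘ W⊆V─H
      W∌X : ∀ {w} → w ∈ W → w ∉ X
      W∌X = x∈p─q⇒x∉q (V ─ H) X ∘ W⊆V─H─X
      W∌Q : ∀ {w} → w ∈ W → w ∉ Q
      W∌Q = x∈p─q⇒x∉q (V ─ H ─ X) Q
      W⊆V : W ⊆ V
      W⊆V = p─q⊆p V H ∘ W⊆V─H
      W⊆G : W ⊆ left g
      W⊆G w∈W = ∉right⇒left g (W⊆V w∈W) (W∌H w∈W)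
      W⊆P : W ⊆ left b
      W⊆P w∈W = ∉right⇒left b (W⊆V w∈W) (W∌Q w∈W)
      W⊆Y : W ⊆ right r
      W⊆Y w∈W = ∉left⇒right r (W⊆V w∈W) (W∌X w∈W)

      class : Fin 4 → Subset n
      class zero = H
      class (suc zero) = X
      class (suc (suc zero)) = Q
      class (suc (suc (suc zero))) = W

      covers-classes : ∀ {v} → v ∈ V → ∃ λ i → v ∈ class i
      covers-classes {v} v∈V with v ∈? H | v ∈? X | v ∈? Q
      ... | yes v∈H | _ | _ = c₁ , v∈H
      ... | no _ | yes v∈X | _ = c₂ , v∈X
      ... | no _ | no _ | yes v∈Q = c₃ , v∈Q
      ... | no v∉H | no v∉X | no v∉Q =
            c₄ , x∈p∧x∉q⇒x∈p─q (x∈p∧x∉q⇒x∈p─q (x∈p∧x∉q⇒x∈p─q v∈V v∉H) v∉X) v∉Q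

      H∌X : ∀ {v} → v ∈ H → v ∉ X
      H∌X v∈H v∈X = disjoint g (X⊆G v∈X) v∈H
      H∌Q : ∀ {v} → v ∈ H → v ∉ Q
      H∌Q v∈H v∈Q = disjoint g (Q⊆G v∈Q) v∈H

      unique-class : ∀ {v} i j → v ∈ class i → v ∈ class j → i ≡ j
      unique-class zero zero _ _ = refl
      unique-class zero (suc zero) v∈H v∈X = contradiction v∈X (H∌X v∈H)
      unique-class zero (suc (suc zero)) v∈H v∈Q = contradiction v∈Q (H∌Q v∈H)
      unique-class zero (suc (suc (suc zero))) v∈H v∈W = contradiction v∈H (W∌H v∈W)
      unique-class (suc zero) zero v∈X v∈H = contradiction v∈X (H∌X v∈H)
      unique-class (suc zero) (suc zero) _ _ = refl
      unique-class (suc zero) (suc (suc zero)) v∈X v∈Q = contradiction v∈Q (corner-empty v∈X)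
      unique-class (suc zero) (suc (suc (suc zero))) v∈X v∈W = contradiction v∈X (W∌X v∈W)
      unique-class (suc (suc zero)) zero v∈Q v∈H = contradiction v∈Q (H∌Q v∈H)
      unique-class (suc (suc zero)) (suc zero) v∈Q v∈X = contradiction v∈Q (corner-empty v∈X)
      unique-class (suc (suc zero)) (suc (suc zero)) _ _ = refl
      unique-class (suc (suc zero)) (suc (suc (suc zero))) v∈Q v∈W = contradiction v∈Q (W∌Q v∈W)
      unique-class (suc (suc (suc zero))) zero v∈W v∈H = contradiction v∈H (W∌H v∈W)
      unique-class (suc (suc (suc zero))) (suc zero) v∈W v∈X = contradiction v∈X (W∌X v∈W)
      unique-class (suc (suc (suc zero))) (suc (suc zero)) v∈W v∈Q = contradiction v∈Q (W∌Q v∈W)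
      unique-class (suc (suc (suc zero))) (suc (suc (suc zero))) _ _ = refl

      open Labelling χ class covers-classes unique-class public

  empty-corner⇒ThreeAndW : ∀ {V m} → 1 ≤ m →
    (r : Separation χ red V m) (b : Separation χ blue V m) → Separation χ green V m →
    (∀ {v} → v ∈ left r → v ∉ right b) → ThreeAndW m χ V
  empty-corner⇒ThreeAndW 1≤m r b g₀ corner-empty
    with g , X⊆G , Q⊆G ← EmptyCorner.green-side r b corner-empty
           (0<∣p∣⇒Nonempty (left r) (≤-trans 1≤m (left-size r)))
           (0<∣p∣⇒Nonempty (right b) (≤-trans 1≤m (right-size b))) g₀ =
    label ,
    ≤-trans (right-size g) (class-size c₁ (right⊆ g)) ,
    ≤-trans (left-size r) (class-size c₂ (left⊆ r)) ,
    ≤-trans (right-size b) (class-size c₃ (right⊆ b)) ,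
    between (_≡ green) (λ q∈Q x∈X → trans (col-sym χ _ _) (X-Q-green x∈X q∈Q)) ,
    between (_≡ blue) (λ h∈H x∈X → ≢red⇒≢green⇒blue (no-c-edges-sym r (H⊆Y h∈H) x∈X)
                                                    (no-c-edges-sym g h∈H (X⊆G x∈X))) ,
    between (_≡ red) (λ h∈H q∈Q → ≢blue⇒≢green⇒red (no-c-edges b (H⊆P h∈H) q∈Q)
                                                   (no-c-edges-sym g h∈H (Q⊆G q∈Q))) ,
    between (λ x → x ≡ red ⊎ x ≡ blue) (λ h∈H w∈W → ≢green⇒red⊎blue (no-c-edges-sym g h∈H (W⊆G w∈W))) ,
    between (λ x → x ≡ red ⊎ x ≡ green) (λ q∈Q w∈W → ≢blue⇒red⊎green (no-c-edges-sym b q∈Q (W⊆P w∈W))) ,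
    between (λ x → x ≡ blue ⊎ x ≡ green) (λ x∈X w∈W → ≢red⇒blue⊎green (no-c-edges r x∈X (W⊆Y w∈W)))
    where
    open EmptyCorner r b corner-empty
    open Classes g X⊆G Q⊆G

  corner : ∀ {V m₁ m₂} → Separation χ red V m₁ → Separation χ blue V m₂ → Fin 4 → Subset n
  corner r b zero = left r ∩ left b
  corner r b (suc zero) = right r ∩ right b
  corner r b (suc (suc zero)) = right r ∩ left b
  corner r b (suc (suc (suc zero))) = left r ∩ right b

  module Corners {V m₁ m₂} (r : Separation χ red V m₁) (b : Separation χ blue V m₂) where

    X Y P Q : Subset n
    X = left r
    Y = right r
    P = left b
    Q = right b
    A : Fin 4 → Subset n
    A = corner r b

    X-of-A₁ : ∀ {v} → v ∈ A c₁ → v ∈ X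
    X-of-A₁ = p∩q⊆p X P
    P-of-A₁ : ∀ {v} → v ∈ A c₁ → v ∈ P
    P-of-A₁ = p∩q⊆q X P
    Y-of-A₂ : ∀ {v} → v ∈ A c₂ → v ∈ Y
    Y-of-A₂ = p∩q⊆p Y Q
    Q-of-A₂ : ∀ {v} → v ∈ A c₂ → v ∈ Q
    Q-of-A₂ = p∩q⊆q Y Q
    Y-of-A₃ : ∀ {v} → v ∈ A c₃ → v ∈ Y
    Y-of-A₃ = p∩q⊆p Y P
    P-of-A₃ : ∀ {v} → v ∈ A c₃ → v ∈ P
    P-of-A₃ = p∩q⊆q Y P
    X-of-A₄ : ∀ {v} → v ∈ A c₄ → v ∈ X
    X-of-A₄ = p∩q⊆p X Q
    Q-of-A₄ : ∀ {v} → v ∈ A c₄ → v ∈ Q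
    Q-of-A₄ = p∩q⊆q X Q

    corner⊆V : ∀ i → A i ⊆ V
    corner⊆V zero = left⊆ r ∘ X-of-A₁
    corner⊆V (suc zero) = right⊆ r ∘ Y-of-A₂
    corner⊆V (suc (suc zero)) = right⊆ r ∘ Y-of-A₃
    corner⊆V (suc (suc (suc zero))) = left⊆ r ∘ X-of-A₄

    covers-corners : ∀ {v} → v ∈ V → ∃ λ i → v ∈ A i
    covers-corners v∈V with covers r v∈V | covers b v∈V
    ... | inj₁ v∈X | inj₁ v∈P = c₁ , x∈p∩q⁺ (v∈X , v∈P)
    ... | inj₂ v∈Y | inj₂ v∈Q = c₂ , x∈p∩q⁺ (v∈Y , v∈Q)
    ... | inj₂ v∈Y | inj₁ v∈P = c₃ , x∈p∩q⁺ (v∈Y , v∈P)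
    ... | inj₁ v∈X | inj₂ v∈Q = c₄ , x∈p∩q⁺ (v∈X , v∈Q)

    red-clash : ∀ {v} {i j : Fin 4} → v ∈ X → v ∈ Y → i ≡ j
    red-clash v∈X v∈Y = contradiction v∈Y (disjoint r v∈X)
    blue-clash : ∀ {v} {i j : Fin 4} → v ∈ P → v ∈ Q → i ≡ j
    blue-clash v∈P v∈Q = contradiction v∈Q (disjoint b v∈P)

    unique-corner : ∀ {v} i j → v ∈ A i → v ∈ A j → i ≡ j
    unique-corner zero zero _ _ = refl
    unique-corner zero (suc zero) v∈ v∈′ = red-clash (X-of-A₁ v∈) (Y-of-A₂ v∈′)
    unique-corner zero (suc (suc zero)) v∈ v∈′ = red-clash (X-of-A₁ v∈) (Y-of-A₃ v∈′)
    unique-corner zero (suc (suc (suc zero))) v∈ v∈′ = blue-clash (P-of-A₁ v∈) (Q-of-A₄ v∈′)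
    unique-corner (suc zero) zero v∈ v∈′ = red-clash (X-of-A₁ v∈′) (Y-of-A₂ v∈)
    unique-corner (suc zero) (suc zero) _ _ = refl
    unique-corner (suc zero) (suc (suc zero)) v∈ v∈′ = blue-clash (P-of-A₃ v∈′) (Q-of-A₂ v∈)
    unique-corner (suc zero) (suc (suc (suc zero))) v∈ v∈′ = red-clash (X-of-A₄ v∈′) (Y-of-A₂ v∈)
    unique-corner (suc (suc zero)) zero v∈ v∈′ = red-clash (X-of-A₁ v∈′) (Y-of-A₃ v∈)
    unique-corner (suc (suc zero)) (suc zero) v∈ v∈′ = blue-clash (P-of-A₃ v∈) (Q-of-A₂ v∈′)
    unique-corner (suc (suc zero)) (suc (suc zero)) _ _ = refl
    unique-corner (suc (suc zero)) (suc (suc (suc zero))) v∈ v∈′ = red-clash (X-of-A₄ v∈′) (Y-of-A₃ v∈)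
    unique-corner (suc (suc (suc zero))) zero v∈ v∈′ = blue-clash (P-of-A₁ v∈′) (Q-of-A₄ v∈)
    unique-corner (suc (suc (suc zero))) (suc zero) v∈ v∈′ = red-clash (X-of-A₄ v∈) (Y-of-A₂ v∈′)
    unique-corner (suc (suc (suc zero))) (suc (suc zero)) v∈ v∈′ = red-clash (X-of-A₄ v∈) (Y-of-A₃ v∈′)
    unique-corner (suc (suc (suc zero))) (suc (suc (suc zero))) _ _ = refl

    A₁-A₂-green : ∀ {x y} → x ∈ A c₁ → y ∈ A c₂ → col χ x y ≡ green
    A₁-A₂-green x∈ y∈ =
      ≢red⇒≢blue⇒green (no-c-edges r (X-of-A₁ x∈) (Y-of-A₂ y∈)) (no-c-edges b (P-of-A₁ x∈) (Q-of-A₂ y∈))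
    A₄-A₃-green : ∀ {x y} → x ∈ A c₄ → y ∈ A c₃ → col χ x y ≡ green
    A₄-A₃-green x∈ y∈ =
      ≢red⇒≢blue⇒green (no-c-edges r (X-of-A₄ x∈) (Y-of-A₃ y∈)) (no-c-edges-sym b (Q-of-A₄ x∈) (P-of-A₃ y∈))

    green-splits-corners : ∀ {m₃} → 1 ≤ m₃ → (∀ i → Nonempty (A i)) → Separation χ green V m₃ →
      Σ (Separation χ green V m₃) λ g → A c₁ ⊆ left g × A c₂ ⊆ left g × A c₃ ⊆ right g × A c₄ ⊆ right g
    green-splits-corners 1≤m₃ element g₀ with orient χ green g₀ (corner⊆V c₁ (proj₂ (element c₁)))
    ... | g , a∈G = g , proj₁ G-block , proj₂ G-block , proj₂ H-block , proj₁ H-block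
      where
      G-block : A c₁ ⊆ left g × A c₂ ⊆ left g
      G-block = complete-bipartite⊆left χ green g (corner⊆V c₁) (corner⊆V c₂) A₁-A₂-green
                  (proj₂ (element c₁)) (proj₂ (element c₂)) a∈G
      d∈A₄ : proj₁ (element c₄) ∈ A c₄
      d∈A₄ = proj₂ (element c₄)
      H-block : A c₄ ⊆ right g × A c₃ ⊆ right g
      H-block with covers g (corner⊆V c₄ d∈A₄)
      ... | inj₂ d∈H = complete-bipartite⊆left χ green (swap χ green g) (corner⊆V c₄) (corner⊆V c₃)
                         A₄-A₃-green d∈A₄ (proj₂ (element c₃)) d∈H
      ... | inj₁ d∈G = contradiction (all-left h∈H) (λ h∈G → disjoint g h∈G h∈H)
        where
        h∈H : proj₁ (0<∣p∣⇒Nonempty (right g) (≤-trans 1≤m₃ (right-size g))) ∈ right g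
        h∈H = proj₂ (0<∣p∣⇒Nonempty (right g) (≤-trans 1≤m₃ (right-size g)))
        rest-left : A c₄ ⊆ left g × A c₃ ⊆ left g
        rest-left = complete-bipartite⊆left χ green g (corner⊆V c₄) (corner⊆V c₃) A₄-A₃-green
                      d∈A₄ (proj₂ (element c₃)) d∈G
        all-left : ∀ {v} → v ∈ right g → v ∈ left g
        all-left v∈H with covers-corners (right⊆ g v∈H)
        ... | zero , v∈A = proj₁ G-block v∈A
        ... | suc zero , v∈A = proj₂ G-block v∈A
        ... | suc (suc zero) , v∈A = proj₂ rest-left v∈A
        ... | suc (suc (suc zero)) , v∈A = proj₁ rest-left v∈A

    open Labelling χ A covers-corners unique-corner public

  big-corners⇒FourPartite : ∀ {V k m₁ m₂ m₃} → 1 ≤ k → 1 ≤ m₃ →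
    (r : Separation χ red V m₁) (b : Separation χ blue V m₂) → Separation χ green V m₃ →
    (∀ i → k ≤ ∣ corner r b i ∣) → FourPartite k χ V
  big-corners⇒FourPartite 1≤k 1≤m₃ r b g₀ big
    with g , A₁⊆G , A₂⊆G , A₃⊆H , A₄⊆H ← Corners.green-splits-corners r b 1≤m₃
           (λ i → 0<∣p∣⇒Nonempty (corner r b i) (≤-trans 1≤k (big i))) g₀ =
    label ,
    (λ i → ≤-trans (big i) (class-size i (corner⊆V i))) ,
    between (_≡ red) (λ x∈ y∈ → ≢blue⇒≢green⇒red (no-c-edges b (P-of-A₁ x∈) (Q-of-A₄ y∈))
                                                  (no-c-edges g (A₁⊆G x∈) (A₄⊆H y∈))) ,
    between (_≡ red) (λ x∈ y∈ → ≢blue⇒≢green⇒red (no-c-edges-sym b (Q-of-A₂ x∈) (P-of-A₃ y∈))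
                                                  (no-c-edges g (A₂⊆G x∈) (A₃⊆H y∈))) ,
    between (_≡ blue) (λ x∈ y∈ → ≢red⇒≢green⇒blue (no-c-edges-sym r (Y-of-A₂ x∈) (X-of-A₄ y∈))
                                                   (no-c-edges g (A₂⊆G x∈) (A₄⊆H y∈))) ,
    between (_≡ blue) (λ x∈ y∈ → ≢red⇒≢green⇒blue (no-c-edges r (X-of-A₁ x∈) (Y-of-A₃ y∈))
                                                   (no-c-edges g (A₁⊆G x∈) (A₃⊆H y∈))) ,
    between (_≡ green) (λ x∈ y∈ → trans (col-sym χ _ _) (A₄-A₃-green y∈ x∈)) ,
    between (_≡ green) A₁-A₂-green
    where open Corners r b

  corner-as-left-right : ∀ {V m₁ m₂} i (r : Separation χ red V m₁) (b : Separation χ blue V m₂) →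
    Σ (Separation χ red V m₁) λ r₀ → Σ (Separation χ blue V m₂) λ b₀ → left r₀ ∩ right b₀ ≡ corner r b i
  corner-as-left-right zero r b = r , swap χ blue b , refl
  corner-as-left-right (suc zero) r b = swap χ red r , b , refl
  corner-as-left-right (suc (suc zero)) r b = swap χ red r , swap χ blue b , refl
  corner-as-left-right (suc (suc (suc zero))) r b = r , b , refl

  small-corner⇒ThreeAndW : ∀ {V m j} → 1 ≤ m →
    (r : Separation χ red V (m + j)) (b : Separation χ blue V (m + j)) → Separation χ green V (m + j) →
    ∀ i → ∣ corner r b i ∣ ≤ j → ThreeAndW m χ (V ─ corner r b i)
  small-corner⇒ThreeAndW 1≤m r b g i ∣C∣≤j with corner-as-left-right i r b
  ... | r₀ , b₀ , r₀∩b₀≡C = empty-corner⇒ThreeAndW 1≤m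
        (restrict χ red C ∣C∣≤j r₀) (restrict χ blue C ∣C∣≤j b₀) (restrict χ green C ∣C∣≤j g) emptied
    where
    C : Subset n
    C = corner r b i
    emptied : ∀ {v} → v ∈ left r₀ ─ C → v ∉ right b₀ ─ C
    emptied v∈ v∈′ = let (v∈left , v∉C) = x∈p─q⁻ (left r₀) C v∈ in
      v∉C (subst (_ ∈_) r₀∩b₀≡C (x∈p∩q⁺ (v∈left , p─q⊆p (right b₀) C v∈′)))

  four-partite-or-three-and-W : ∀ {V m j} → 1 ≤ m →
    Separation χ red V (m + j) → Separation χ blue V (m + j) → Separation χ green V (m + j) →
    ∃ λ C → ∣ C ∣ ≤ j × (FourPartite (suc j) χ (V ─ C) ⊎ ThreeAndW m χ (V ─ C))
  four-partite-or-three-and-W {V} {m} {j} 1≤m r b g with any? (λ i → ¬? (suc j ≤? ∣ corner r b i ∣))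
  ... | yes (i , small) =
        corner r b i , ≤-pred (≰⇒> small) , inj₂ (small-corner⇒ThreeAndW 1≤m r b g i (≤-pred (≰⇒> small)))
  ... | no ∄small = ⊥ , subst (_≤ j) (sym (∣⊥∣≡0 n)) z≤n , inj₁ (subst (FourPartite (suc j) χ) (sym (p─⊥≡p V))
        (big-corners⇒FourPartite (s≤s z≤n) (≤-trans 1≤m (m≤m+n m j)) r b g
          λ i → decidable-stable (suc j ≤? ∣ corner r b i ∣) λ ¬big → ∄small (i , ¬big)))

Conclusion : ∀ {n} → Colouring n → Subset n → Set
Conclusion χ V = (EmptySet V ⊎ Σ Colour (λ c → KConnectedIn 4 χ c V))
               ⊎ FourPartite 3 χ V
               ⊎ ThreeAndW 400 χ V

Result : ∀ {n} → Colouring n → Set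
Result χ = ∃ λ V → ∣ ∁ V ∣ < 41002 × Conclusion χ V

module _ {n : ℕ} (χ : Colouring n) (41002≤n : 41002 ≤ n) where

  enough : ∀ V {a b} → ∣ ∁ V ∣ ≤ a → {T (b + a ≤ᵇ 41002)} → b ≤ ∣ V ∣
  enough V {a} {b} ∣∁V∣≤a {b+a≤41002} = +-cancelʳ-≤ a b ∣ V ∣ (begin
    b + a              ≤⟨ ≤ᵇ⇒≤ (b + a) 41002 b+a≤41002 ⟩
    41002              ≤⟨ 41002≤n ⟩
    n                  ≤⟨ n≤∣p∣+∣∁p∣ V ⟩
    ∣ V ∣ + ∣ ∁ V ∣    ≤⟨ +-monoʳ-≤ ∣ V ∣ ∣∁V∣≤a ⟩
    ∣ V ∣ + a          ∎)
    where open ≤-Reasoning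

  result : ∀ V {a} → ∣ ∁ V ∣ ≤ a → {T (suc a ≤ᵇ 41002)} → Conclusion χ V → Result χ
  result V {a} ∣∁V∣≤a {a<41002} conclusion = V , ≤-<-trans ∣∁V∣≤a (≤ᵇ⇒≤ (suc a) 41002 a<41002) , conclusion

  after-green : ∀ {V} → ∣ ∁ V ∣ ≤ 3 * 6432 + 3 * 1608 →
    Separation χ red V 1608 → Separation χ blue V 1608 → Outcome χ green V 402 → Result χ
  after-green {V} removed _ _ (inj₁ (D , ∣D∣≤ , conn)) =
    result (V ─ D) (∣∁[p─q]∣≤a+k V D removed ∣D∣≤) (inj₁ (inj₂ (green , conn)))
  after-green {V} removed red₂ blue₂ (inj₂ (T₃ , ∣T₃∣≤ , green₃))
    with C , ∣C∣≤2 , partite ← four-partite-or-three-and-W {m = 400} (s≤s z≤n)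
           (restrict χ red T₃ ∣T₃∣≤ red₂) (restrict χ blue T₃ ∣T₃∣≤ blue₂) green₃ =
    result (V ─ T₃ ─ C) (∣∁[p─q]∣≤a+k (V ─ T₃) C (∣∁[p─q]∣≤a+k V T₃ removed ∣T₃∣≤) ∣C∣≤2) (inj₂ partite)

  after-blue : ∀ {V} → ∣ ∁ V ∣ ≤ 3 * 6432 → Separation χ red V 6432 → Outcome χ blue V 1608 → Result χ
  after-blue {V} removed _ (inj₁ (D , ∣D∣≤ , conn)) =
    result (V ─ D) (∣∁[p─q]∣≤a+k V D removed ∣D∣≤) (inj₁ (inj₂ (blue , conn)))
  after-blue {V} removed red₁ (inj₂ (T₂ , ∣T₂∣≤ , blue₂)) =
    after-green removed₂ (restrict χ red {m = 1608} T₂ ∣T₂∣≤ red₁) blue₂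
      (connected-or-separated χ green (V ─ T₂) 402 (s≤s z≤n) (enough (V ─ T₂) removed₂))
    where
    removed₂ : ∣ ∁ (V ─ T₂) ∣ ≤ 3 * 6432 + 3 * 1608
    -- explicit bounds: otherwise the unifier tries to invert _+_ against a numeral
    removed₂ = ∣∁[p─q]∣≤a+k V T₂ {3 * 6432} {3 * 1608} removed ∣T₂∣≤

  after-red : ∀ {V} → ∣ ∁ V ∣ ≤ 0 → Outcome χ red V 6432 → Result χ
  after-red {V} removed (inj₁ (D , ∣D∣≤ , conn)) =
    result (V ─ D) (∣∁[p─q]∣≤a+k V D removed ∣D∣≤) (inj₁ (inj₂ (red , conn)))
  after-red {V} removed (inj₂ (T₁ , ∣T₁∣≤ , red₁)) =
    after-blue removed₁ red₁
      (connected-or-separated χ blue (V ─ T₁) 1608 (s≤s z≤n) (enough (V ─ T₁) removed₁))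
    where
    removed₁ : ∣ ∁ (V ─ T₁) ∣ ≤ 3 * 6432
    removed₁ = ∣∁[p─q]∣≤a+k V T₁ {0} {3 * 6432} removed ∣T₁∣≤

  three-stages : Result χ
  three-stages = after-red removed₀ (connected-or-separated χ red ⊤ 6432 (s≤s z≤n) (enough ⊤ removed₀))
    where
    removed₀ : ∣ ∁ (⊤ {n}) ∣ ≤ 0
    removed₀ = ≤-reflexive (trans (∣∁p∣≡n∸∣p∣ (⊤ {n})) (trans (cong (n ∸_) (∣⊤∣≡n n)) (n∸n≡0 n)))

remaining-vertices : ∀ {n} (χ : Colouring n) → Dec (n < 41002) → Result χ
remaining-vertices {n} χ (yes n<41002) =
  ⊥ , subst (_< 41002) (sym (trans (∣∁p∣≡n∸∣p∣ (⊥ {n})) (cong (n ∸_) (∣⊥∣≡0 n)))) n<41002 ,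
  inj₁ (inj₁ λ _ → ∉⊥)
remaining-vertices χ (no n≮41002) = three-stages χ (≮⇒≥ n≮41002)

lemma5p6 : (n : ℕ) (χ : Colouring n) → Σ (Subset n) λ S → ∣ S ∣ < 41002 ×
    ((EmptySet (∁ S) ⊎ Σ Colour (λ c → KConnectedIn 4 χ c (∁ S)))
     ⊎ FourPartite 3 χ (∁ S)
     ⊎ ThreeAndW 400 χ (∁ S))
lemma5p6 n χ = complement (remaining-vertices χ (n <? 41002))
  where
  complement : Result χ → Σ (Subset n) λ S → ∣ S ∣ < 41002 × Conclusion χ (∁ S)
  complement (V , ∣∁V∣<41002 , conclusion) =
    ∁ V , ∣∁V∣<41002 , subst (Conclusion χ) (sym (∁-involutive V)) conclusion
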